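{- For any sequence $p=(p_1,p_2,\dots)$ of positive reals and any finite $S\subseteq\mathbb{N}$, let $i$ be the smallest positive integer not in $S$. Then \[p_i\big(\varphi_{S\cup\{i\}}(p)-\varphi_S(p)\big)=1+\sum_{j\in S}p_j\big(\varphi_S(p)-\varphi_{S\setminus\{j\}}(p)\big),\] equivalently $\mathbf{I}^S_{S\cup\{i\}}(p)=1+\sum_{j\in S}\mathbf{I}^{S\setminus\{j\}}_S(p)$.
   Context: Write $[m]=\{1,\dots,m\}$, $\mathbb{N}=\{1,2,\dots\}$. For positive reals $p_1,p_2,\dots$ and each finite $S\subseteq\mathbb{N}$, a real number $\varphi_S(p)$ (depending only on $p_1,\dots,p_{\max S}$) is defined by induction on the largest element of $S$. For $T$ finite and $i\in T$ write $\mathbf{I}^{T\setminus\{i\}}_T(p)=p_i\big(\varphi_T(p)-\varphi_{T\setminus\{i\}}(p)\big)$ (so also $\mathbf{I}^{T}_{T\cup\{i\}}(p)=p_i(\varphi_{T\cup\{i\}}(p)-\varphi_T(p))$ for $i\notin T$). Set $\varphi_\emptyset(p)=0$. Given $\varphi_T$ for all $T\subseteq[k-1]$, let the numbers $f_S(p)$, $S\subseteq[k]$ with $k\in S$, be the unique solution of the (strictly diagonally dominant) linear system: for $S\ne[k]$, with $i<k$ the smallest element of $[k]\setminus S$, $\big(p_i+\sum_{j\in S}p_j\big)f_S(p)=p_if_{S\cup\{i\}}(p)+\sum_{j\in S\setminus\{k\}}p_jf_{S\setminus\{j\}}(p)$; and $f_{[k]}(p)=1+\sum_{j=1}^{k-1}\mathbf{I}^{[k-1]\setminus\{j\}}_{[k-1]}(p)$.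 Then for $S\subseteq[k]$ with $k\in S$ define $\varphi_S(p)=\varphi_{S\setminus\{k\}}(p)+f_S(p)/p_k$. -}

module Defs where

open import Level using (0ℓ)
open import Data.Nat as ℕ using (ℕ; zero; suc; _≡ᵇ_)
open import Data.Bool using (Bool; true; false; if_then_else_; _∧_)
open import Data.Vec using (Vec; []; _∷_; replicate)
open import Data.Product using (Σ; ∃; _×_)
open import Data.Sum using (_⊎_)
open import Relation.Nullary using (¬_)
open import Relation.Binary.PropositionalEquality using (_≡_)
open import Relation.Binary.Structures using (IsStrictTotalOrder)
open import Algebra.Structures using (IsCommutativeRing)

-- The real numbers, axiomatised as a complete ordered field
-- (Dedekind-complete ordered fields are exactly ℝ up to isomorphism).

record RealField : Set₁ where
  infixl 6 _+_ _-_
  infixl 7 _*_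
  infix 4 _<_ _≤_
  field
    ℝ : Set
    0r 1r : ℝ
    _+_ _*_ : ℝ → ℝ → ℝ
    -_ : ℝ → ℝ
    _<_ : ℝ → ℝ → Set
    isCommutativeRing : IsCommutativeRing _≡_ _+_ _*_ -_ 0r 1r
    inverse : ∀ x → ¬ (x ≡ 0r) → Σ ℝ (λ y → x * y ≡ 1r)
    isStrictTotalOrder : IsStrictTotalOrder _≡_ _<_
    +-monoˡ-< : ∀ {x y} z → x < y → x + z < y + z
    *-pos : ∀ {x y} → 0r < x → 0r < y → 0r < x * y

  _-_ : ℝ → ℝ → ℝ
  x - y = x + (- y)

  _≤_ : ℝ → ℝ → Set
  x ≤ y = x < y ⊎ x ≡ y

  field
    sup : (P : ℝ → Set) → ∃ P → ∃ (λ b → ∀ x → P x → x ≤ b) →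
          ∃ (λ s → (∀ x → P x → x ≤ s) × (∀ b → (∀ x → P x → x ≤ b) → s ≤ b))

-- Finite subsets of ℕ = {1,2,...}.
-- `Sub k` represents a subset of [k] = {1,...,k}; the vector is listed
-- from the LARGEST element downwards: (b ∷ S) : Sub (suc k) means
-- "suc k ∈ set iff b", and S : Sub k describes the rest.
-- A finite set S ⊆ ℕ is represented by any S' : Sub k with S ⊆ [k]
-- (padding with `false ∷` adds non-elements on top).

Sub : ℕ → Set
Sub k = Vec Bool k

mem : ∀ {k} → Sub k → ℕ → Bool
mem [] j = false
mem {suc k} (b ∷ S) j = if j ≡ᵇ suc k then b else mem S j

update : ∀ {k} → ℕ → Bool → Sub k → Sub k
update j c [] = []
update {suc k} j c (b ∷ S) = if j ≡ᵇ suc k then c ∷ S else b ∷ update j c S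

insert remove : ∀ {k} → ℕ → Sub k → Sub k
insert j S = update j true S
remove j S = update j false S

full : (k : ℕ) → Sub k
full k = replicate k true

-- smallest positive integer not in S (for S : Sub k it lies in [k+1])
mex : ∀ {k} → Sub k → ℕ
mex [] = 1
mex {suc k} (b ∷ S) = if (mex S ≡ᵇ suc k) ∧ b then suc (suc k) else mex S

module Sums (R : RealField) where
  open RealField R

  sumTo : ℕ → (ℕ → ℝ) → ℝ
  sumTo zero f = 0r
  sumTo (suc k) f = sumTo k f + f (suc k)

  sumIn : ∀ {k} → Sub k → (ℕ → ℝ) → ℝ
  sumIn {k} S f = sumTo k (λ j → if mem S j then f j else 0r)

-- The defining relations of φ.  φ k S is φ_S(p) for S : Sub k.

module Phi (R : RealField) (p : ℕ → RealField.ℝ R) where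
  open RealField R
  open Sums R

  record IsPhi (φ : (k : ℕ) → Sub k → ℝ) : Set where
    -- f_S for S = T ∪ {k}, T ⊆ [k-1], k = suc m : f_S = p_k (φ_S − φ_{S∖{k}})
    f : (m : ℕ) → Sub m → ℝ
    f m T = p (suc m) * (φ (suc m) (true ∷ T) - φ m T)
    field
      phi-empty : φ zero [] ≡ 0r
      -- φ_S depends only on the set S (not on the ambient [k])
      phi-pad : ∀ k (S : Sub k) → φ (suc k) (false ∷ S) ≡ φ k S
      f-full : ∀ m → f m (full m) ≡
        1r + sumTo m (λ j → p j * (φ m (full m) - φ m (remove j (full m))))
      f-system : ∀ m (T : Sub m) → ¬ (T ≡ full m) →
        (p (mex T) + (p (suc m) + sumIn T p)) * f m T ≡
        p (mex T) * f m (insert (mex T) T) + sumIn T (λ j → p j * f m (remove j T))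

module Submission where

-- Three cases arise.
--   * S = false ∷ S'  (k ∉ S): padding changes neither φ, nor the mex, nor the
--     differences I^{S∖{j}}_S, so the identity is the one for S'.
--   * S = [k]: then i = k+1 and the identity is literally the normalisation
--     f_{[k]} = 1 + Σ_j I^{[k]∖{j}}_{[k]} of the defining system.
--   * S = T ∪ {k} with T ≠ [k-1]: then i = mex T ≤ k-1, and the defining linear
--     equation for f_S (all f's carry the common factor p_k), together with
--     the induction hypothesis for T, yields the identity for S after
--     cancelling the positive factor p_k.

open import Defs
open import Data.Nat using (ℕ; suc)
open import Data.Bool using (false)
open import Data.Vec using (_∷_)
open import Relation.Binary.PropositionalEquality using (_≡_)

open import Level using (0ℓ)
open import Data.Nat as N using (zero; _≡ᵇ_; z≤n; s≤s)
open import Data.Nat.Properties using (≤-refl; ≤-reflexive; m≤n⇒m≤1+n; 1+n≰n; +-suc)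
open import Data.Bool using (true; if_then_else_)
open import Data.Vec using ([])
open import Data.Product using (_,_)
open import Data.Sum using (_⊎_; inj₁; inj₂)
open import Relation.Nullary using (¬_)
open import Relation.Binary.PropositionalEquality
  using (refl; sym; trans; cong; cong₂; subst; module ≡-Reasoning)
open import Relation.Binary.Structures using (IsStrictTotalOrder)
open import Algebra.Bundles using (CommutativeRing)
open import Algebra.Solver.Ring.AlmostCommutativeRing
  using (fromCommutativeRing; _-Raw-AlmostCommutative⟶_)
open import Data.Integer as Z using (ℤ)

≤⇒≢ᵇsuc : ∀ {j k} → j N.≤ k → (j ≡ᵇ suc k) ≡ false
≤⇒≢ᵇsuc z≤n = refl
≤⇒≢ᵇsuc (s≤s j≤k) = ≤⇒≢ᵇsuc j≤k

≡ᵇ-refl : ∀ n → (n ≡ᵇ n) ≡ true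
≡ᵇ-refl zero = refl
≡ᵇ-refl (suc n) = ≡ᵇ-refl n

mem-below : ∀ {k} b (S : Sub k) {j} → j N.≤ k → mem (b ∷ S) j ≡ mem S j
mem-below b S j≤k rewrite ≤⇒≢ᵇsuc j≤k = refl

mem-top : ∀ {k} b (S : Sub k) → mem (b ∷ S) (suc k) ≡ b
mem-top {k} b S rewrite ≡ᵇ-refl k = refl

update-below : ∀ {k} j c b (S : Sub k) → j N.≤ k → update j c (b ∷ S) ≡ b ∷ update j c S
update-below j c b S j≤k rewrite ≤⇒≢ᵇsuc j≤k = refl

update-top : ∀ {k} c b (S : Sub k) → update (suc k) c (b ∷ S) ≡ c ∷ S
update-top {k} c b S rewrite ≡ᵇ-refl k = refl

mex-full : ∀ k → mex (full k) ≡ suc k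
mex-full zero = refl
mex-full (suc k) rewrite mex-full k | ≡ᵇ-refl k = refl

mex-pad : ∀ {k} (S : Sub k) → mex (false ∷ S) ≡ mex S
mex-pad {k} S with mex S ≡ᵇ suc k
... | true = refl
... | false = refl

mex-below : ∀ {k} b (S : Sub k) → mex S N.≤ k → mex (b ∷ S) ≡ mex S
mex-below b S i≤k rewrite ≤⇒≢ᵇsuc i≤k = refl

mex-cases : ∀ {k} (S : Sub k) → S ≡ full k ⊎ mex S N.≤ k
mex-cases [] = inj₁ refl
mex-cases {suc k} (b ∷ S) with mex-cases S | b
... | inj₁ refl | true = inj₁ refl
... | inj₁ refl | false = inj₂ (≤-reflexive (trans (mex-pad (full k)) (mex-full k)))
... | inj₂ i≤k | b' =
  inj₂ (subst (N._≤ suc k) (sym (mex-below b' S i≤k)) (m≤n⇒m≤1+n i≤k))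

mex-≤ : ∀ {k} (S : Sub k) → mex S N.≤ suc k
mex-≤ {k} S with mex-cases S
... | inj₁ refl = ≤-reflexive (mex-full k)
... | inj₂ i≤k = m≤n⇒m≤1+n i≤k

-- The canonical ring homomorphism ℤ → R into any commutative ring; it lets
-- the standard ring solver normalise polynomial identities in R, using
-- integer coefficients (whose equality is decidable by computation).
module IntegerCoefficients {c ℓ} (CR : CommutativeRing c ℓ) where
  open import Data.Maybe using (Maybe; just; nothing)
  open import Data.Integer using (+_; -[1+_]; _⊖_; _◃_)
  open import Data.Integer.Properties using ([1+m]⊖[1+n]≡m⊖n)
  import Data.Sign as Sg
  open import Relation.Nullary using (yes; no)
  open CommutativeRing CR renaming (refl to ≈-refl; sym to ≈-sym; trans to ≈-trans)
  open import Relation.Binary.Reasoning.Setoid setoid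
  open import Algebra.Properties.Ring ring using (-0#≈0#; -‿involutive; -‿+-comm; -‿distribˡ-*; -‿distribʳ-*)
  open import Algebra.Properties.Semiring.Mult semiring using (_×_; ×-homo-+; ×1-homo-*)
  open import Algebra.Properties.CommutativeSemigroup +-commutativeSemigroup using (interchange)

  ι : ℕ → Carrier
  ι n = n × 1#

  ⟦_⟧ℤ : ℤ → Carrier
  ⟦ + n ⟧ℤ = ι n
  ⟦ -[1+ n ] ⟧ℤ = - ι (suc n)

  ι-+ : ∀ m n → ι (m N.+ n) ≈ ι m + ι n
  ι-+ = ×-homo-+ 1#

  ⊖-homo : ∀ m n → ⟦ m ⊖ n ⟧ℤ ≈ ι m - ι n
  ⊖-homo zero zero = ≈-sym (-‿inverseʳ 0#)
  ⊖-homo (suc m) zero = ≈-sym (≈-trans (+-congˡ -0#≈0#) (+-identityʳ _))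
  ⊖-homo zero (suc n) = ≈-sym (+-identityˡ _)
  ⊖-homo (suc m) (suc n) = begin
    ⟦ suc m ⊖ suc n ⟧ℤ           ≡⟨ cong ⟦_⟧ℤ ([1+m]⊖[1+n]≡m⊖n m n) ⟩
    ⟦ m ⊖ n ⟧ℤ                   ≈⟨ ⊖-homo m n ⟩
    ι m - ι n                    ≈⟨ +-identityˡ _ ⟨
    0# + (ι m - ι n)             ≈⟨ +-congʳ (-‿inverseʳ 1#) ⟨
    (1# - 1#) + (ι m - ι n)      ≈⟨ interchange 1# (- 1#) (ι m) (- ι n) ⟩
    (1# + ι m) + (- 1# - ι n)    ≈⟨ +-congˡ (-‿+-comm 1# (ι n)) ⟩
    ι (suc m) - ι (suc n)        ∎

  +-homo : ∀ i j → ⟦ i Z.+ j ⟧ℤ ≈ ⟦ i ⟧ℤ + ⟦ j ⟧ℤ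
  +-homo (+ m) (+ n) = ι-+ m n
  +-homo (+ m) -[1+ n ] = ⊖-homo m (suc n)
  +-homo -[1+ m ] (+ n) = ≈-trans (⊖-homo n (suc m)) (+-comm _ _)
  +-homo -[1+ m ] -[1+ n ] = begin
    - ι (suc (suc (m N.+ n)))    ≡⟨ cong (λ k → - ι (suc k)) (sym (+-suc m n)) ⟩
    - ι (suc m N.+ suc n)        ≈⟨ -‿cong (ι-+ (suc m) (suc n)) ⟩
    - (ι (suc m) + ι (suc n))    ≈⟨ -‿+-comm _ _ ⟨
    - ι (suc m) - ι (suc n)      ∎

  -- integer products are formed with sign ◃ magnitude
  +◃-homo : ∀ n → ⟦ Sg.+ ◃ n ⟧ℤ ≈ ι n
  +◃-homo zero = ≈-refl
  +◃-homo (suc n) = ≈-refl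

  -◃-homo : ∀ n → ⟦ Sg.- ◃ n ⟧ℤ ≈ - ι n
  -◃-homo zero = ≈-sym -0#≈0#
  -◃-homo (suc n) = ≈-refl

  *-homo : ∀ i j → ⟦ i Z.* j ⟧ℤ ≈ ⟦ i ⟧ℤ * ⟦ j ⟧ℤ
  *-homo (+ m) (+ n) = ≈-trans (+◃-homo (m N.* n)) (×1-homo-* m n)
  *-homo (+ m) -[1+ n ] = begin
    ⟦ Sg.- ◃ (m N.* suc n) ⟧ℤ    ≈⟨ -◃-homo (m N.* suc n) ⟩
    - ι (m N.* suc n)            ≈⟨ -‿cong (×1-homo-* m (suc n)) ⟩
    - (ι m * ι (suc n))          ≈⟨ -‿distribʳ-* _ _ ⟩
    ι m * - ι (suc n)            ∎
  *-homo -[1+ m ] (+ n) = begin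
    ⟦ Sg.- ◃ (suc m N.* n) ⟧ℤ    ≈⟨ -◃-homo (suc m N.* n) ⟩
    - ι (suc m N.* n)            ≈⟨ -‿cong (×1-homo-* (suc m) n) ⟩
    - (ι (suc m) * ι n)          ≈⟨ -‿distribˡ-* _ _ ⟩
    - ι (suc m) * ι n            ∎
  *-homo -[1+ m ] -[1+ n ] = begin
    ι (suc m N.* suc n)          ≈⟨ ×1-homo-* (suc m) (suc n) ⟩
    ι (suc m) * ι (suc n)        ≈⟨ -‿involutive _ ⟨
    - - (ι (suc m) * ι (suc n))  ≈⟨ -‿cong (-‿distribˡ-* _ _) ⟩
    - (- ι (suc m) * ι (suc n))  ≈⟨ -‿distribʳ-* _ _ ⟩
    - ι (suc m) * - ι (suc n)    ∎

  -‿homo : ∀ i → ⟦ Z.- i ⟧ℤ ≈ - ⟦ i ⟧ℤ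
  -‿homo (+ zero) = ≈-sym -0#≈0#
  -‿homo (+ suc n) = ≈-refl
  -‿homo -[1+ n ] = ≈-sym (-‿involutive _)

  ℤ⟶R : Z.+-*-rawRing -Raw-AlmostCommutative⟶ fromCommutativeRing CR
  ℤ⟶R = record
    { ⟦_⟧ = ⟦_⟧ℤ ; +-homo = +-homo ; *-homo = *-homo ; -‿homo = -‿homo
    ; 0-homo = ≈-refl ; 1-homo = +-identityʳ 1# }

  coefficient≟ : ∀ i j → Maybe (⟦ i ⟧ℤ ≈ ⟦ j ⟧ℤ)
  coefficient≟ i j with i Z.≟ j
  ... | yes refl = just ≈-refl
  ... | no _ = nothing

  open import Algebra.Solver.Ring Z.+-*-rawRing (fromCommutativeRing CR) ℤ⟶R coefficient≟ public
    using (solve; _:=_; _:+_; _:*_; _:-_; con)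

module RealFacts (R : RealField) where
  open RealField R
  open Sums R
  open ≡-Reasoning

  commutativeRing : CommutativeRing 0ℓ 0ℓ
  commutativeRing = record { isCommutativeRing = isCommutativeRing }

  open IntegerCoefficients commutativeRing public using (solve; _:=_; _:+_; _:*_; _:-_; con)
  open CommutativeRing commutativeRing using (*-identityˡ; +-identityʳ)

  pos⇒≢0 : ∀ {x} → 0r < x → ¬ x ≡ 0r
  pos⇒≢0 pos refl = IsStrictTotalOrder.irrefl isStrictTotalOrder refl pos

  *-cancelˡ : ∀ {P x y} → ¬ P ≡ 0r → P * x ≡ P * y → x ≡ y
  *-cancelˡ {P} {x} {y} P≢0 eq with inverse P P≢0
  ... | q , Pq≡1 = begin
    x                ≡⟨ sym (*-identityˡ x) ⟩
    1r * x           ≡⟨ cong (_* x) (sym Pq≡1) ⟩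
    (P * q) * x      ≡⟨ solve 3 (λ x P q → (P :* q) :* x := q :* (P :* x)) refl x P q ⟩
    q * (P * x)      ≡⟨ cong (q *_) eq ⟩
    q * (P * y)      ≡⟨ solve 3 (λ y P q → q :* (P :* y) := (P :* q) :* y) refl y P q ⟩
    (P * q) * y      ≡⟨ cong (_* y) Pq≡1 ⟩
    1r * y           ≡⟨ *-identityˡ y ⟩
    y                ∎

  sumTo-cong : ∀ n {f g : ℕ → ℝ} → (∀ j → 1 N.≤ j → j N.≤ n → f j ≡ g j) →
               sumTo n f ≡ sumTo n g
  sumTo-cong zero h = refl
  sumTo-cong (suc n) h =
    cong₂ _+_ (sumTo-cong n (λ j 1≤j j≤n → h j 1≤j (m≤n⇒m≤1+n j≤n))) (h (suc n) (s≤s z≤n) ≤-refl)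

  linear-zero : ∀ c P → P * 0r ≡ 0r * c - 0r + P * 0r
  linear-zero c P = solve 2 (λ c P → P :* con (Z.+ 0) := con (Z.+ 0) :* c :- con (Z.+ 0) :+ P :* con (Z.+ 0)) refl c P

  sumTo-linear : ∀ n {u a b d : ℕ → ℝ} {c P : ℝ} →
    (∀ j → 1 N.≤ j → j N.≤ n → P * u j ≡ a j * c - b j + P * d j) →
    P * sumTo n u ≡ sumTo n a * c - sumTo n b + P * sumTo n d
  sumTo-linear zero {c = c} {P} h = linear-zero c P
  sumTo-linear (suc n) {u} {a} {b} {d} {c} {P} h = begin
    P * (sumTo n u + u (suc n))
      ≡⟨ solve 3 (λ P x y → P :* (x :+ y) := P :* x :+ P :* y) refl P (sumTo n u) (u (suc n)) ⟩
    P * sumTo n u + P * u (suc n)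
      ≡⟨ cong₂ _+_ (sumTo-linear n (λ j 1≤j j≤n → h j 1≤j (m≤n⇒m≤1+n j≤n)))
                   (h (suc n) (s≤s z≤n) ≤-refl) ⟩
    (A * c - B + P * D) + (a (suc n) * c - b (suc n) + P * d (suc n))
      ≡⟨ solve 8 (λ A B D x y z c P →
           (A :* c :- B :+ P :* D) :+ (x :* c :- y :+ P :* z) :=
           (A :+ x) :* c :- (B :+ y) :+ P :* (D :+ z))
           refl A B D (a (suc n)) (b (suc n)) (d (suc n)) c P ⟩
    (A + a (suc n)) * c - (B + b (suc n)) + P * (D + d (suc n)) ∎
    where
    A B D : ℝ
    A = sumTo n a
    B = sumTo n b
    D = sumTo n d

  sumIn-cong : ∀ {k} (S : Sub k) {f g : ℕ → ℝ} → (∀ j → 1 N.≤ j → j N.≤ k → f j ≡ g j) →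
               sumIn S f ≡ sumIn S g
  sumIn-cong {k} S h =
    sumTo-cong k (λ j 1≤j j≤k → cong (λ x → if mem S j then x else 0r) (h j 1≤j j≤k))

  sumIn-linear : ∀ {k} (S : Sub k) {u a b d : ℕ → ℝ} {c P : ℝ} →
    (∀ j → 1 N.≤ j → j N.≤ k → P * u j ≡ a j * c - b j + P * d j) →
    P * sumIn S u ≡ sumIn S a * c - sumIn S b + P * sumIn S d
  sumIn-linear {k} S {u} {a} {b} {d} {c} {P} h = sumTo-linear k restricted
    where
    restricted : ∀ j → 1 N.≤ j → j N.≤ k →
      P * (if mem S j then u j else 0r) ≡
      (if mem S j then a j else 0r) * c - (if mem S j then b j else 0r)
        + P * (if mem S j then d j else 0r)
    restricted j 1≤j j≤k with mem S j
    ... | true = h j 1≤j j≤k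
    ... | false = linear-zero c P

  sumIn-cons : ∀ {k} b (S : Sub k) (f : ℕ → ℝ) →
               sumIn (b ∷ S) f ≡ sumIn S f + (if b then f (suc k) else 0r)
  sumIn-cons {k} b S f = cong₂ _+_
    (sumTo-cong k (λ j _ j≤k → cong (λ c → if c then f j else 0r) (mem-below b S j≤k)))
    (cong (λ c → if c then f (suc k) else 0r) (mem-top b S))

  sumIn-pad : ∀ {k} (S : Sub k) (f : ℕ → ℝ) → sumIn (false ∷ S) f ≡ sumIn S f
  sumIn-pad S f = trans (sumIn-cons false S f) (+-identityʳ (sumIn S f))

  sumIn-full : ∀ k (f : ℕ → ℝ) → sumIn (full k) f ≡ sumTo k f
  sumIn-full zero f = refl
  sumIn-full (suc k) f =
    trans (sumIn-cons true (full k) f) (cong (_+ f (suc k)) (sumIn-full k f))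

  -- With a = φ_{S∪i},
  -- b = φ_{T∪i}, c = φ_S, d = φ_T, q = p_i, P = p_k: from the induction
  -- hypothesis, the defining equation of f_S = P(c − d), and the linear
  -- relation for the sums, cancelling P gives the identity for S.
  step-algebra : ∀ {P q a b c d σP σB σD σU} → ¬ P ≡ 0r →
    q * (b - d) ≡ 1r + σD →
    (q + (P + σP)) * (P * (c - d)) ≡ q * (P * (a - b)) + σB →
    P * σU ≡ σP * (P * (c - d)) - σB + P * σD →
    q * (a - c) ≡ 1r + (σU + P * (c - d))
  step-algebra {P} {q} {a} {b} {c} {d} {σP} {σB} {σD} {σU} P≢0 ih system sums =
    *-cancelˡ P≢0 (begin
      P * (q * (a - c))
        ≡⟨ solve 8 (λ P q a b c d σB one →
             P :* (q :* (a :- c)) :=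
             (q :* (P :* (a :- b)) :+ σB) :- q :* (P :* (c :- d)) :- σB :+ P :* (q :* (b :- d)))
             refl P q a b c d σB 1r ⟩
      (q * (P * (a - b)) + σB) - q * fS - σB + P * (q * (b - d))
        ≡⟨ cong₂ (λ s t → s - q * fS - σB + P * t) (sym system) ih ⟩
      (q + (P + σP)) * fS - q * fS - σB + P * (1r + σD)
        ≡⟨ solve 7 (λ P q σP σB σD one fS →
             (q :+ (P :+ σP)) :* fS :- q :* fS :- σB :+ P :* (one :+ σD) :=
             P :* one :+ (σP :* fS :- σB :+ P :* σD) :+ P :* fS)
             refl P q σP σB σD 1r fS ⟩
      P * 1r + (σP * fS - σB + P * σD) + P * fS
        ≡⟨ cong (λ t → P * 1r + t + P * fS) (sym sums) ⟩
      P * 1r + P * σU + P * fS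
        ≡⟨ solve 4 (λ P one σU fS → P :* one :+ P :* σU :+ P :* fS := P :* (one :+ (σU :+ fS)))
             refl P 1r σU fS ⟩
      P * (1r + (σU + fS)) ∎)
    where
    fS : ℝ
    fS = P * (c - d)

module MexIdentity (R : RealField) (p : ℕ → RealField.ℝ R)
  (p-pos : ∀ i → RealField._<_ R (RealField.0r R) (p i))
  (φ : (k : ℕ) → Sub k → RealField.ℝ R) (isφ : Phi.IsPhi R p φ) where

  open RealField R
  open Sums R
  open RealFacts R
  open Phi.IsPhi isφ
  open ≡-Reasoning

  -- Δ k S j = I^{S∖{j}}_S = p_j (φ_S − φ_{S∖{j}}).
  Δ : ∀ k → Sub k → ℕ → ℝ
  Δ k S j = p j * (φ k S - φ k (remove j S))

  -- Δ⁺ k S = I^S_{S∪{i}} = p_i (φ_{S∪{i}} − φ_S) for i the mex of S.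
  Δ⁺ : ∀ k → Sub k → ℝ
  Δ⁺ k S = p (mex S) * (φ (suc k) (insert (mex S) (false ∷ S)) - φ k S)

  Claim : ∀ k → Sub k → Set
  Claim k S = Δ⁺ k S ≡ 1r + sumIn S (Δ k S)

  φ-insert-pad : ∀ {k} i (S : Sub k) → i N.≤ k →
                 φ (suc k) (insert i (false ∷ S)) ≡ φ k (insert i S)
  φ-insert-pad i S i≤k =
    trans (cong (φ _) (update-below i true false S i≤k)) (phi-pad _ (insert i S))

  Δ-pad : ∀ {m} (S : Sub m) j → j N.≤ m → Δ (suc m) (false ∷ S) j ≡ Δ m S j
  Δ-pad S j j≤m = cong₂ (λ x y → p j * (x - y)) (phi-pad _ S)
    (trans (cong (φ _) (update-below j false false S j≤m)) (phi-pad _ (remove j S)))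

  Δ⁺-pad : ∀ {m} (S : Sub m) → Δ⁺ (suc m) (false ∷ S) ≡ Δ⁺ m S
  Δ⁺-pad {m} S rewrite mex-pad S =
    cong₂ (λ x y → p (mex S) * (x - y)) (φ-insert-pad (mex S) (false ∷ S) (mex-≤ S)) (phi-pad m S)

  pad-case : ∀ m (S : Sub m) → Claim m S → Claim (suc m) (false ∷ S)
  pad-case m S ih = begin
    Δ⁺ (suc m) (false ∷ S)                        ≡⟨ Δ⁺-pad S ⟩
    Δ⁺ m S                                        ≡⟨ ih ⟩
    1r + sumIn S (Δ m S)                          ≡⟨ cong (1r +_) (sumIn-cong S (λ j _ j≤m → sym (Δ-pad S j j≤m))) ⟩
    1r + sumIn S (Δ (suc m) (false ∷ S))          ≡⟨ cong (1r +_) (sym (sumIn-pad S _)) ⟩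
    1r + sumIn (false ∷ S) (Δ (suc m) (false ∷ S)) ∎

  full-case : ∀ k → Claim k (full k)
  full-case k = begin
    Δ⁺ k (full k)
      ≡⟨ cong (λ i → p i * (φ (suc k) (insert i (false ∷ full k)) - φ k (full k))) (mex-full k) ⟩
    p (suc k) * (φ (suc k) (insert (suc k) (false ∷ full k)) - φ k (full k))
      ≡⟨ cong (λ X → p (suc k) * (φ (suc k) X - φ k (full k))) (update-top true false (full k)) ⟩
    f k (full k)                                  ≡⟨ f-full k ⟩
    1r + sumTo k (Δ k (full k))                   ≡⟨ cong (1r +_) (sym (sumIn-full k _)) ⟩
    1r + sumIn (full k) (Δ k (full k))            ∎

  step-case : ∀ m (T : Sub m) → mex T N.≤ m → Claim m T → Claim (suc m) (true ∷ T)
  step-case m T i≤m ih = begin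
    Δ⁺ (suc m) S                                  ≡⟨ mex-step ⟩
    p i * (φ (suc m) (true ∷ insert i T) - φ (suc m) S)
      ≡⟨ step-algebra (pos⇒≢0 (p-pos (suc m))) ih' system sums ⟩
    1r + (sumIn T (Δ (suc m) S) + f m T)          ≡⟨ cong (λ t → 1r + (sumIn T (Δ (suc m) S) + t)) (sym top) ⟩
    1r + (sumIn T (Δ (suc m) S) + Δ (suc m) S (suc m))
                                                  ≡⟨ cong (1r +_) (sym (sumIn-cons true T _)) ⟩
    1r + sumIn S (Δ (suc m) S)                    ∎
    where
    S : Sub (suc m)
    S = true ∷ T
    i : ℕ
    i = mex T

    T≢full : ¬ T ≡ full m
    T≢full T≡full = 1+n≰n (subst (N._≤ m) (trans (cong mex T≡full) (mex-full m)) i≤m)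

    mex-step : Δ⁺ (suc m) S ≡ p i * (φ (suc m) (true ∷ insert i T) - φ (suc m) S)
    mex-step rewrite mex-below true T i≤m = cong (λ x → p i * (x - φ (suc m) S)) (begin
      φ (suc (suc m)) (insert i (false ∷ S))      ≡⟨ φ-insert-pad i S (m≤n⇒m≤1+n i≤m) ⟩
      φ (suc m) (insert i S)                      ≡⟨ cong (φ (suc m)) (update-below i true true T i≤m) ⟩
      φ (suc m) (true ∷ insert i T)               ∎)

    ih' : p i * (φ m (insert i T) - φ m T) ≡ 1r + sumIn T (Δ m T)
    ih' = trans (cong (λ x → p i * (x - φ m T)) (sym (φ-insert-pad i T i≤m))) ih

    system : (p i + (p (suc m) + sumIn T p)) * f m T ≡
             p i * f m (insert i T) + sumIn T (λ j → p j * f m (remove j T))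
    system = f-system m T T≢full

    top : Δ (suc m) S (suc m) ≡ f m T
    top = cong (λ x → p (suc m) * (φ (suc m) S - x))
               (trans (cong (φ (suc m)) (update-top false true T)) (phi-pad m T))

    sums : p (suc m) * sumIn T (Δ (suc m) S) ≡
           sumIn T p * f m T - sumIn T (λ j → p j * f m (remove j T)) + p (suc m) * sumIn T (Δ m T)
    sums = sumIn-linear T pointwise
      where
      pointwise : ∀ j → 1 N.≤ j → j N.≤ m →
        p (suc m) * Δ (suc m) S j ≡ p j * f m T - p j * f m (remove j T) + p (suc m) * Δ m T j
      pointwise j _ j≤m rewrite update-below j false true T j≤m =
        solve 6 (λ P q φS X φT Y →
          P :* (q :* (φS :- X)) := q :* (P :* (φS :- φT)) :- q :* (P :* (X :- Y)) :+ P :* (q :* (φT :- Y)))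
          refl (p (suc m)) (p j) (φ (suc m) S) (φ (suc m) (true ∷ remove j T)) (φ m T) (φ m (remove j T))

  claim : ∀ k (S : Sub k) → Claim k S
  claim zero [] = full-case zero
  claim (suc m) (false ∷ S) = pad-case m S (claim m S)
  claim (suc m) (true ∷ T) with mex-cases T
  ... | inj₁ refl = full-case (suc m)
  ... | inj₂ i≤m = step-case m T i≤m (claim m T)

lemma1 : (R : RealField) (p : ℕ → RealField.ℝ R) →
         (∀ i → RealField._<_ R (RealField.0r R) (p i)) →
         (φ : (k : ℕ) → Sub k → RealField.ℝ R) → Phi.IsPhi R p φ →
         ∀ k (S : Sub k) →
         RealField._*_ R (p (mex S))
           (RealField._-_ R (φ (suc k) (insert (mex S) (false ∷ S))) (φ k S))
         ≡ RealField._+_ R (RealField.1r R)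
             (Sums.sumIn R S (λ j → RealField._*_ R (p j)
               (RealField._-_ R (φ k S) (φ k (remove j S)))))
lemma1 R p p-pos φ isφ = MexIdentity.claim R p p-pos φ isφ
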